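{- Let $R$ be a monotone transit function on a non-empty finite set $V$ and $\mathscr{C}_R=\{R(x,y)\mid x,y\in V\}$. Then $\mathscr{C}_R$ is $\gamma$-acyclic if and only if $\mathscr{C}_R$ is a hierarchy.
   Context: A transit function on $V$ is a map $R:V\times V\to 2^V$ with $u\in R(u,v)$, $R(u,v)=R(v,u)$, $R(u,u)=\{u\}$; monotone means $p,q\in R(u,v)$ implies $R(p,q)\subseteq R(u,v)$. A weak $\beta$-cycle in a set system $\mathscr{C}$ is a sequence of $n\ge3$ sets $C_1,\dots,C_n\in\mathscr{C}$ and vertices $x_1,\dots,x_n$ with $x_i\in C_i\cap C_{i+1}$ and $x_i\notin C_k$ for $k\notin\{i,i+1\}$ (indices modulo $n$). A pure cycle is a weak $\beta$-cycle with $C_i\cap C_j=\emptyset$ whenever $j\notin\{i-1,i,i+1\}$. A $\gamma$-triangle consists of three pairwise intersecting sets $C_1,C_2,C_3\in\mathscr{C}$ such that there are $u,v\in C_3$ with $u\in C_1\setminus C_2$ and $v\in C_2\setminus C_1$. $\mathscr{C}$ is $\gamma$-acyclic if it contains neither a pure cycle nor a $\gamma$-triangle. A set system $\mathscr{C}$ on $V$ is a hierarchy if $V\in\mathscr{C}$, all singletons belong to $\mathscr{C}$, and $A\cap B\in\{A,B,\emptyset\}$ for all $A,B\in\mathscr{C}$. -}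

module Defs where

open import Data.Nat as ℕ using (ℕ; suc)
open import Data.Nat.DivMod using (_%_; m%n<n)
open import Data.Fin using (Fin; toℕ; fromℕ<)
open import Data.Fin.Subset using (Subset; _∈_; _∉_; _⊆_; _∩_; ⁅_⁆; ⊤; ⊥; Nonempty)
open import Data.Product using (Σ; ∃; ∃-syntax; _×_)
open import Data.Sum using (_⊎_)
open import Relation.Binary.PropositionalEquality using (_≡_; _≢_)
open import Relation.Nullary using (¬_)

SetSystem : ℕ → Set₁
SetSystem n = Subset n → Set

record IsTransit {n : ℕ} (R : Fin n → Fin n → Subset n) : Set where
  field
    refl-mem : ∀ u v → u ∈ R u v
    symm     : ∀ u v → R u v ≡ R v u
    idem     : ∀ u → R u u ≡ ⁅ u ⁆

Monotone : {n : ℕ} → (Fin n → Fin n → Subset n) → Set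
Monotone R = ∀ u v p q → p ∈ R u v → q ∈ R u v → R p q ⊆ R u v

𝒞 : {n : ℕ} → (Fin n → Fin n → Subset n) → SetSystem n
𝒞 R S = ∃[ x ] ∃[ y ] (S ≡ R x y)

next : {k : ℕ} → Fin (suc k) → Fin (suc k)
next {k} i = fromℕ< (m%n<n (suc (toℕ i)) (suc k))

record IsWeakβCycle {n : ℕ} (𝓒 : SetSystem n) (m : ℕ)
         (C : Fin (suc (suc (suc m))) → Subset n)
         (x : Fin (suc (suc (suc m))) → Fin n) : Set where
  field
    inSys  : ∀ i → 𝓒 (C i)
    memL   : ∀ i → x i ∈ C i
    memR   : ∀ i → x i ∈ C (next i)
    notMem : ∀ i j → j ≢ i → j ≢ next i → x i ∉ C j

record IsPureCycle {n : ℕ} (𝓒 : SetSystem n) (m : ℕ)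
         (C : Fin (suc (suc (suc m))) → Subset n)
         (x : Fin (suc (suc (suc m))) → Fin n) : Set where
  field
    weak     : IsWeakβCycle 𝓒 m C x
    disjoint : ∀ i j → j ≢ i → j ≢ next i → next j ≢ i → C i ∩ C j ≡ ⊥

HasPureCycle : {n : ℕ} → SetSystem n → Set
HasPureCycle 𝓒 = ∃[ m ] Σ (Fin (suc (suc (suc m))) → Subset _) λ C →
                   Σ (Fin (suc (suc (suc m))) → Fin _) λ x → IsPureCycle 𝓒 m C x

IsγTriangle : {n : ℕ} → SetSystem n → Subset n → Subset n → Subset n → Set
IsγTriangle 𝓒 C₁ C₂ C₃ =
  𝓒 C₁ × 𝓒 C₂ × 𝓒 C₃ ×
  Nonempty (C₁ ∩ C₂) × Nonempty (C₁ ∩ C₃) × Nonempty (C₂ ∩ C₃) ×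
  ∃[ u ] ∃[ v ] (u ∈ C₃ × v ∈ C₃ × u ∈ C₁ × u ∉ C₂ × v ∈ C₂ × v ∉ C₁)

HasγTriangle : {n : ℕ} → SetSystem n → Set
HasγTriangle 𝓒 = ∃[ C₁ ] ∃[ C₂ ] ∃[ C₃ ] IsγTriangle 𝓒 C₁ C₂ C₃

γ-Acyclic : {n : ℕ} → SetSystem n → Set
γ-Acyclic 𝓒 = ¬ HasPureCycle 𝓒 × ¬ HasγTriangle 𝓒

record IsHierarchy {n : ℕ} (𝓒 : SetSystem n) : Set where
  field
    full       : 𝓒 ⊤
    singletons : ∀ x → 𝓒 ⁅ x ⁆
    laminar    : ∀ A B → 𝓒 A → 𝓒 B → (A ∩ B ≡ A) ⊎ (A ∩ B ≡ B) ⊎ (A ∩ B ≡ ⊥)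

-- Every interval R(u,v) contains u and v, so a non-laminar pair A, B of sets in 𝒞_R,
-- with u ∈ A ∖ B and v ∈ B ∖ A, forms a γ-triangle together with R(u,v). Conversely a
-- laminar system has no γ-triangle, and not even a weak β-cycle: two consecutive sets
-- C₁, C₂ of such a cycle meet in x₁, and whichever contains the other also contains
-- x₀ or x₂. Finally, in a laminar 𝒞_R the intervals R(a,_) are nested, so the largest
-- of them contains every vertex and V = R(a,c) ∈ 𝒞_R.
module Submission where

open import Defs
open import Data.Nat using (ℕ; suc; zero)
open import Data.Fin using (Fin)
import Data.Fin as Fin
open import Data.Fin.Subset using (Subset; _∈_; _∉_; _⊆_; _∩_; ⊤; ⊥)
open import Data.Fin.Subset.Properties
open import Data.Fin.Properties using (¬∀⟶∃¬)
open import Data.Product using (_×_; _,_; proj₁; proj₂; ∃-syntax)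
open import Data.Sum using (_⊎_; inj₁; inj₂)
open import Data.Empty using (⊥-elim)
open import Data.List using (List; []; _∷_; allFin)
open import Data.List.Relation.Unary.All as All using (All; []; _∷_)
open import Data.List.Membership.Propositional.Properties using (∈-allFin)
open import Relation.Binary.PropositionalEquality using (_≡_; _≢_; refl; sym; subst)
open import Relation.Nullary using (¬_; yes; no; contradiction)
open import Relation.Nullary.Decidable using (_→-dec_)

module _ {n : ℕ} {p q : Subset n} where

  p⊆q⇒p∩q≡p : p ⊆ q → p ∩ q ≡ p
  p⊆q⇒p∩q≡p p⊆q = ⊆-antisym (p∩q⊆p p q) (λ x∈p → x∈p∩q⁺ (x∈p , p⊆q x∈p))

  q⊆p⇒p∩q≡q : q ⊆ p → p ∩ q ≡ q
  q⊆p⇒p∩q≡q q⊆p = ⊆-antisym (p∩q⊆q p q) (λ x∈q → x∈p∩q⁺ (q⊆p x∈q , x∈q))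

  p∩q≡p⇒p⊆q : p ∩ q ≡ p → p ⊆ q
  p∩q≡p⇒p⊆q eq x∈p = proj₂ (x∈p∩q⁻ p q (subst (_ ∈_) (sym eq) x∈p))

  p∩q≡q⇒q⊆p : p ∩ q ≡ q → q ⊆ p
  p∩q≡q⇒q⊆p eq x∈q = proj₁ (x∈p∩q⁻ p q (subst (_ ∈_) (sym eq) x∈q))

  p∩q≡⊥⇒∉ : ∀ {x} → p ∩ q ≡ ⊥ → x ∈ p → x ∉ q
  p∩q≡⊥⇒∉ eq x∈p x∈q = ∉⊥ (subst (_ ∈_) eq (x∈p∩q⁺ (x∈p , x∈q)))

  ⊈⇒∃∈∉ : ¬ p ⊆ q → ∃[ x ] x ∈ p × x ∉ q
  ⊈⇒∃∈∉ p⊈q with ¬∀⟶∃¬ n (λ x → x ∈ p → x ∈ q) (λ x → (x ∈? p) →-dec (x ∈? q))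
                          (λ p→q → p⊈q (λ {x} → p→q x))
  ... | x , ¬p→q with x ∈? p
  ...   | yes x∈p = x , x∈p , λ x∈q → ¬p→q (λ _ → x∈q)
  ...   | no  x∉p = contradiction (λ x∈p → contradiction x∈p x∉p) ¬p→q

Laminar : {n : ℕ} → SetSystem n → Set
Laminar 𝓒 = ∀ A B → 𝓒 A → 𝓒 B → (A ∩ B ≡ A) ⊎ (A ∩ B ≡ B) ⊎ (A ∩ B ≡ ⊥)

module _ {n : ℕ} {𝓒 : SetSystem n} (laminar : Laminar 𝓒) where

  laminar⇒¬γTriangle : ¬ HasγTriangle 𝓒
  laminar⇒¬γTriangle (C₁ , C₂ , _ , C₁∈ , C₂∈ , _ , (x , x∈C₁∩C₂) , _ , _ ,
                       _ , _ , _ , _ , u∈C₁ , u∉C₂ , v∈C₂ , v∉C₁)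
    with laminar C₁ C₂ C₁∈ C₂∈
  ... | inj₁ C₁∩C₂≡C₁        = u∉C₂ (p∩q≡p⇒p⊆q C₁∩C₂≡C₁ u∈C₁)
  ... | inj₂ (inj₁ C₁∩C₂≡C₂) = v∉C₁ (p∩q≡q⇒q⊆p C₁∩C₂≡C₂ v∈C₂)
  ... | inj₂ (inj₂ C₁∩C₂≡⊥)  = ∉⊥ (subst (x ∈_) C₁∩C₂≡⊥ x∈C₁∩C₂)

  laminar⇒¬weakβCycle : ∀ m C x → ¬ IsWeakβCycle 𝓒 m C x
  laminar⇒¬weakβCycle m C x cycle = nested-or-disjoint (laminar (C one) (C two) (inSys one) (inSys two))
    where
      open IsWeakβCycle cycle
      one two : Fin (suc (suc (suc m)))
      one = Fin.suc Fin.zero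
      two = Fin.suc (Fin.suc Fin.zero)

      one≢next-two : ∀ k → Fin.suc Fin.zero ≢ next {suc (suc k)} (Fin.suc (Fin.suc Fin.zero))
      one≢next-two zero    ()
      one≢next-two (suc k) ()

      nested-or-disjoint : ¬ ((C one ∩ C two ≡ C one) ⊎ (C one ∩ C two ≡ C two) ⊎ (C one ∩ C two ≡ ⊥))
      nested-or-disjoint (inj₁ C₁∩C₂≡C₁) =
        notMem Fin.zero two (λ ()) (λ ()) (p∩q≡p⇒p⊆q C₁∩C₂≡C₁ (memR Fin.zero))
      nested-or-disjoint (inj₂ (inj₁ C₁∩C₂≡C₂)) =
        notMem two one (λ ()) (one≢next-two m) (p∩q≡q⇒q⊆p C₁∩C₂≡C₂ (memL two))
      nested-or-disjoint (inj₂ (inj₂ C₁∩C₂≡⊥)) = p∩q≡⊥⇒∉ C₁∩C₂≡⊥ (memL one) (memR one)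

  laminar⇒¬pureCycle : ¬ HasPureCycle 𝓒
  laminar⇒¬pureCycle (m , C , x , pure) = laminar⇒¬weakβCycle m C x (IsPureCycle.weak pure)

  laminar⇒γ-acyclic : γ-Acyclic 𝓒
  laminar⇒γ-acyclic = laminar⇒¬pureCycle , laminar⇒¬γTriangle

¬γTriangle⇒laminar : {n : ℕ} {𝓒 : SetSystem n} →
                     (∀ u v → ∃[ C ] 𝓒 C × u ∈ C × v ∈ C) →
                     ¬ HasγTriangle 𝓒 → Laminar 𝓒
¬γTriangle⇒laminar covers noTriangle A B A∈ B∈ with A ⊆? B | B ⊆? A | nonempty? (A ∩ B)
... | yes A⊆B | _       | _        = inj₁ (p⊆q⇒p∩q≡p A⊆B)
... | no _    | yes B⊆A | _        = inj₂ (inj₁ (q⊆p⇒p∩q≡q B⊆A))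
... | no _    | no _    | no A∩B=∅ = inj₂ (inj₂ (Empty-unique A∩B=∅))
... | no A⊈B  | no B⊈A  | yes A∩B≠∅
  with ⊈⇒∃∈∉ A⊈B | ⊈⇒∃∈∉ B⊈A
...   | u , u∈A , u∉B | v , v∈B , v∉A with covers u v
...     | C , C∈ , u∈C , v∈C =
  ⊥-elim (noTriangle (A , B , C , A∈ , B∈ , C∈ , A∩B≠∅ ,
                      (u , x∈p∩q⁺ (u∈A , u∈C)) , (v , x∈p∩q⁺ (v∈B , v∈C)) ,
                      u , v , u∈C , v∈C , u∈A , u∉B , v∈B , v∉A))

module _ {n : ℕ} {R : Fin n → Fin n → Subset n} (transit : IsTransit R) where
  open IsTransit transit

  ∈R-right : ∀ u v → v ∈ R u v
  ∈R-right u v = subst (v ∈_) (symm v u) (refl-mem v u)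

  intervals-cover : ∀ u v → ∃[ C ] 𝒞 R C × u ∈ C × v ∈ C
  intervals-cover u v = R u v , (u , v , refl) , refl-mem u v , ∈R-right u v

  module _ (laminar : Laminar (𝒞 R)) where

    laminar⇒intervals-nested : ∀ a c z → z ∉ R a c → R a c ⊆ R a z
    laminar⇒intervals-nested a c z z∉Rac
      with laminar (R a z) (R a c) (a , z , refl) (a , c , refl)
    ... | inj₁ Raz∩Rac≡Raz = contradiction (p∩q≡p⇒p⊆q Raz∩Rac≡Raz (∈R-right a z)) z∉Rac
    ... | inj₂ (inj₁ Raz∩Rac≡Rac) = p∩q≡q⇒q⊆p Raz∩Rac≡Rac
    ... | inj₂ (inj₂ Raz∩Rac≡⊥) = contradiction (refl-mem a c) (p∩q≡⊥⇒∉ Raz∩Rac≡⊥ (refl-mem a z))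

    laminar⇒interval-⊇ : ∀ a (zs : List (Fin n)) → ∃[ c ] All (_∈ R a c) zs
    laminar⇒interval-⊇ a [] = a , []
    laminar⇒interval-⊇ a (z ∷ zs) with laminar⇒interval-⊇ a zs
    ... | c , zs⊆Rac with z ∈? R a c
    ...   | yes z∈Rac = c , z∈Rac ∷ zs⊆Rac
    ...   | no  z∉Rac = z , ∈R-right a z ∷ All.map (laminar⇒intervals-nested a c z z∉Rac) zs⊆Rac

    laminar⇒⊤∈𝒞 : Fin n → 𝒞 R ⊤
    laminar⇒⊤∈𝒞 a with laminar⇒interval-⊇ a (allFin n)
    ... | c , V⊆Rac = a , c , ⊆-antisym (λ {x} _ → All.lookup V⊆Rac (∈-allFin x)) ⊆⊤

mainTheorem6 : (n : ℕ) (R : Fin (suc n) → Fin (suc n) → Subset (suc n)) →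
               IsTransit R → Monotone R →
               (γ-Acyclic (𝒞 R) → IsHierarchy (𝒞 R)) × (IsHierarchy (𝒞 R) → γ-Acyclic (𝒞 R))
mainTheorem6 n R transit _ = γ-acyclic⇒hierarchy , λ H → laminar⇒γ-acyclic (IsHierarchy.laminar H)
  where
    γ-acyclic⇒hierarchy : γ-Acyclic (𝒞 R) → IsHierarchy (𝒞 R)
    γ-acyclic⇒hierarchy (_ , noTriangle) = record
      { full       = laminar⇒⊤∈𝒞 transit laminar Fin.zero
      ; singletons = λ x → x , x , sym (IsTransit.idem transit x)
      ; laminar    = laminar
      }
      where
        laminar : Laminar (𝒞 R)
        laminar = ¬γTriangle⇒laminar (intervals-cover transit) noTriangle
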